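{- Let $r\geq1$ and $d\geq 1$ be integers. For integers $l\geq 1$ and $m\geq 0$ define $$f_{l,m}=\sum_{i=0}^{l-1}(-1)^{l-1-i}\binom{l-1}{i}\big[(ri+r)^m-(ri+r-1)^m\big].$$ Then for $1\leq l\leq d-1$ and $1\leq m\leq d$, $$\sum_{j=1}^{m}r^j\binom{m}{j}f_{l,m-j}=f_{l+1,m}.$$
   Context: Convention $0^0=1$. -}

module Defs where

open import Data.Nat using (ℕ; zero; suc; _∸_)
open import Data.Nat.Combinatorics using (_C_)
open import Data.Integer using (ℤ; +_; _+_; _-_; _*_; _^_; -1ℤ)

sumTo : ℕ → (ℕ → ℤ) → ℤ
sumTo zero    g = + 0
sumTo (suc n) g = sumTo n g + g n

sumFrom1 : ℕ → (ℕ → ℤ) → ℤ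
sumFrom1 n g = sumTo n (λ k → g (suc k))

-- f_{l,m} = Σ_{i=0}^{l-1} (-1)^{l-1-i} C(l-1,i) [ (r i + r)^m - (r i + r - 1)^m ]
-- (integer powers; Data.Integer._^_ satisfies x ^ 0 = 1, so 0^0 = 1)
f : (r l m : ℕ) → ℤ
f r l m = sumTo l (λ i →
  (-1ℤ ^ (l ∸ 1 ∸ i)) * (+ ((l ∸ 1) C i)) *
    (((+ r) * (+ i) + (+ r)) ^ m - ((+ r) * (+ i) + (+ r) - + 1) ^ m))

-- Write g r m i = (ri + r)^m − (ri + r − 1)^m and let Δ be the forward difference in i.
-- Then f r l m = (Δ^(l−1) (g r m))(0), written Δ (l − 1) (g r m) below: the alternating
-- binomial sum is the usual expansion of an iterated difference. By the binomial theorem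
-- (z + r)^m − z^m = Σ_{j ≥ 1} r^j C(m,j) z^(m−j), so Σ_{j ≥ 1} r^j C(m,j) g r (m−j) = Δ (g r m),
-- and applying the linear map Δ^(l−1) at 0 turns the left-hand side into (Δ^l (g r m))(0).

module Submission where

open import Defs
open import Data.Nat using (ℕ; _≤_; _+_; _∸_)
open import Data.Nat.Combinatorics using (_C_)
open import Data.Integer using (ℤ; +_; _*_; _^_)
open import Relation.Binary.PropositionalEquality using (_≡_)

open import Algebra.Bundles using (CommutativeSemiring)
import Algebra.Definitions.RawSemiring as SemiringDefinitions
import Algebra.Properties.CommutativeSemiring.Binomial as Binomial
open import Data.Bool.Base using (true; false; T)
open import Data.Fin.Base using (toℕ)
open import Data.Integer.Base using (-_; -1ℤ) renaming (_+_ to _⊕_; _-_ to _⊖_)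
import Data.Integer.Properties as ℤP
open import Data.Integer.Tactic.RingSolver using (solve-∀)
import Data.Nat.Base as ℕ
open import Data.Nat.Combinatorics using (nCk+nC[k+1]≡[n+1]C[k+1])
import Data.Nat.Properties as ℕP
open import Data.Unit.Base using (tt)
open import Function.Base using (_∘_)
open import Relation.Binary.PropositionalEquality using (refl; sym; trans; cong; cong₂; subst; module ≡-Reasoning)
open import Relation.Nullary using (yes; no; contradiction)

open ≡-Reasoning

C-vanishes : ∀ {n k} → n ℕ.< k → n C k ≡ 0
C-vanishes {n} {k} n<k with k ℕ.≤ᵇ n in k≤ᵇn
... | false = refl
... | true  = contradiction (ℕP.≤ᵇ⇒≤ k n (subst T (sym k≤ᵇn) tt)) (ℕP.<⇒≱ n<k)

sumTo-cong : ∀ n {g h : ℕ → ℤ} → (∀ i → g i ≡ h i) → sumTo n g ≡ sumTo n h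
sumTo-cong ℕ.zero    g≡h = refl
sumTo-cong (ℕ.suc n) g≡h = cong₂ _⊕_ (sumTo-cong n g≡h) (g≡h n)

sumTo-zero : ∀ n → sumTo n (λ _ → + 0) ≡ + 0
sumTo-zero ℕ.zero    = refl
sumTo-zero (ℕ.suc n) = cong (_⊕ + 0) (sumTo-zero n)

sumTo-suc : ∀ n (g : ℕ → ℤ) → sumTo (ℕ.suc n) g ≡ g 0 ⊕ sumTo n (g ∘ ℕ.suc)
sumTo-suc ℕ.zero    g = ℤP.+-comm (+ 0) (g 0)
sumTo-suc (ℕ.suc n) g = trans (cong (_⊕ g (ℕ.suc n)) (sumTo-suc n g)) (ℤP.+-assoc (g 0) _ _)

sumTo-distrib-+ : ∀ n (g h : ℕ → ℤ) → sumTo n (λ i → g i ⊕ h i) ≡ sumTo n g ⊕ sumTo n h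
sumTo-distrib-+ ℕ.zero    g h = refl
sumTo-distrib-+ (ℕ.suc n) g h =
  trans (cong (_⊕ (g n ⊕ h n)) (sumTo-distrib-+ n g h)) (interchange (sumTo n g) (sumTo n h) (g n) (h n))
  where
  interchange : ∀ a b c d → (a ⊕ b) ⊕ (c ⊕ d) ≡ (a ⊕ c) ⊕ (b ⊕ d)
  interchange = solve-∀

*-distribˡ-sumTo : ∀ n c (g : ℕ → ℤ) → c * sumTo n g ≡ sumTo n (λ i → c * g i)
*-distribˡ-sumTo ℕ.zero    c g = ℤP.*-zeroʳ c
*-distribˡ-sumTo (ℕ.suc n) c g =
  trans (ℤP.*-distribˡ-+ c (sumTo n g) (g n)) (cong (_⊕ c * g n) (*-distribˡ-sumTo n c g))

sumTo-distrib-⊖ : ∀ n (g h : ℕ → ℤ) → sumTo n (λ i → g i ⊖ h i) ≡ sumTo n g ⊖ sumTo n h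
sumTo-distrib-⊖ n g h = begin
  sumTo n (λ i → g i ⊖ h i)              ≡⟨ sumTo-distrib-+ n g (λ i → - h i) ⟩
  sumTo n g ⊕ sumTo n (λ i → - h i)      ≡⟨ cong (sumTo n g ⊕_) (sumTo-cong n (sym ∘ ℤP.-1*i≡-i ∘ h)) ⟩
  sumTo n g ⊕ sumTo n (λ i → -1ℤ * h i)  ≡⟨ cong (sumTo n g ⊕_) (sym (*-distribˡ-sumTo n -1ℤ h)) ⟩
  sumTo n g ⊕ -1ℤ * sumTo n h            ≡⟨ cong (sumTo n g ⊕_) (ℤP.-1*i≡-i (sumTo n h)) ⟩
  sumTo n g ⊖ sumTo n h                  ∎

sumTo-comm : ∀ m n (F : ℕ → ℕ → ℤ) →
  sumTo m (λ j → sumTo n (F j)) ≡ sumTo n (λ i → sumTo m (λ j → F j i))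
sumTo-comm ℕ.zero    n F = sym (sumTo-zero n)
sumTo-comm (ℕ.suc m) n F =
  trans (cong (_⊕ sumTo n (F m)) (sumTo-comm m n F))
        (sym (sumTo-distrib-+ n (λ i → sumTo m (λ j → F j i)) (F m)))

*-distribˡ-⊖ : ∀ a x y → a * (x ⊖ y) ≡ a * x ⊖ a * y
*-distribˡ-⊖ = solve-∀

*-distribʳ-⊖ : ∀ a b x → (a ⊖ b) * x ≡ a * x ⊖ b * x
*-distribʳ-⊖ = solve-∀

module _ where
  open CommutativeSemiring ℤP.+-*-commutativeSemiring using (rawSemiring)
  open SemiringDefinitions rawSemiring using (_×_; sum) renaming (_^_ to _^ₛ_)

  private
    ^ₛ≡^ : ∀ x n → x ^ₛ n ≡ x ^ n
    ^ₛ≡^ x ℕ.zero    = refl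
    ^ₛ≡^ x (ℕ.suc n) = cong (x *_) (^ₛ≡^ x n)

    ×≡* : ∀ n x → n × x ≡ + n * x
    ×≡* ℕ.zero    x = sym (ℤP.*-zeroˡ x)
    ×≡* (ℕ.suc n) x = trans (cong (_⊕_ x) (×≡* n x)) (sym (ℤP.suc-* (+ n) x))

    sum≡sumTo : ∀ n (g : ℕ → ℤ) → sum {n} (g ∘ toℕ) ≡ sumTo n g
    sum≡sumTo ℕ.zero    g = refl
    sum≡sumTo (ℕ.suc n) g =
      trans (cong (_⊕_ (g 0)) (sum≡sumTo n (g ∘ ℕ.suc))) (sym (sumTo-suc n g))

  binomial-theorem : ∀ n x y → (x ⊕ y) ^ n ≡ sumTo (ℕ.suc n) (λ k → x ^ k * + (n C k) * y ^ (n ∸ k))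
  binomial-theorem n x y = begin
    (x ⊕ y) ^ n                     ≡⟨ ^ₛ≡^ (x ⊕ y) n ⟨
    (x ⊕ y) ^ₛ n                    ≡⟨ Binomial.theorem ℤP.+-*-commutativeSemiring n x y ⟩
    sum {ℕ.suc n} (term ∘ toℕ)      ≡⟨ sum≡sumTo (ℕ.suc n) term ⟩
    sumTo (ℕ.suc n) term            ≡⟨ sumTo-cong (ℕ.suc n) term≡ ⟩
    sumTo (ℕ.suc n) (λ k → x ^ k * + (n C k) * y ^ (n ∸ k)) ∎
    where
    term : ℕ → ℤ
    term k = (n C k) × (x ^ₛ k * y ^ₛ (n ∸ k))
    reorder : ∀ c a b → c * (a * b) ≡ a * c * b
    reorder = solve-∀
    term≡ : ∀ k → term k ≡ x ^ k * + (n C k) * y ^ (n ∸ k)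
    term≡ k = trans (×≡* (n C k) _)
      (trans (cong₂ (λ a b → + (n C k) * (a * b)) (^ₛ≡^ x k) (^ₛ≡^ y (n ∸ k)))
             (reorder (+ (n C k)) (x ^ k) (y ^ (n ∸ k))))

alternatingC : ℕ → ℕ → ℤ
alternatingC k i = -1ℤ ^ (k ∸ i) * + (k C i)

Δ : ℕ → (ℕ → ℤ) → ℤ
Δ k h = sumTo (ℕ.suc k) (λ i → alternatingC k i * h i)

alternatingC-vanishes : ∀ {k i} → k ℕ.< i → alternatingC k i ≡ + 0
alternatingC-vanishes {k} {i} k<i =
  trans (cong (λ c → -1ℤ ^ (k ∸ i) * + c) (C-vanishes k<i)) (ℤP.*-zeroʳ (-1ℤ ^ (k ∸ i)))

alternatingC-suc-zero : ∀ k → alternatingC (ℕ.suc k) 0 ≡ - alternatingC k 0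
alternatingC-suc-zero k = begin
  -1ℤ * -1ℤ ^ k * + 1       ≡⟨ cong (_* + 1) (ℤP.-1*i≡-i (-1ℤ ^ k)) ⟩
  - (-1ℤ ^ k) * + 1         ≡⟨ ℤP.neg-distribˡ-* (-1ℤ ^ k) (+ 1) ⟨
  - (-1ℤ ^ k * + 1)         ∎

-1^[k∸i]*C[k,1+i] : ∀ k i → -1ℤ ^ (k ∸ i) * + (k C ℕ.suc i) ≡ - alternatingC k (ℕ.suc i)
-1^[k∸i]*C[k,1+i] k i with i ℕP.<? k
... | yes i<k = begin
  -1ℤ ^ (k ∸ i) * c                   ≡⟨ cong (λ e → -1ℤ ^ e * c) (ℕP.+-∸-assoc 1 i<k) ⟩
  -1ℤ * -1ℤ ^ (k ∸ ℕ.suc i) * c       ≡⟨ cong (_* c) (ℤP.-1*i≡-i (-1ℤ ^ (k ∸ ℕ.suc i))) ⟩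
  - (-1ℤ ^ (k ∸ ℕ.suc i)) * c         ≡⟨ ℤP.neg-distribˡ-* (-1ℤ ^ (k ∸ ℕ.suc i)) c ⟨
  - alternatingC k (ℕ.suc i)          ∎
  where c = + (k C ℕ.suc i)
... | no i≮k = begin
  -1ℤ ^ (k ∸ i) * + (k C ℕ.suc i)     ≡⟨ cong (λ c → -1ℤ ^ (k ∸ i) * + c) (C-vanishes k<1+i) ⟩
  -1ℤ ^ (k ∸ i) * + 0                 ≡⟨ ℤP.*-zeroʳ (-1ℤ ^ (k ∸ i)) ⟩
  - + 0                               ≡⟨ cong -_ (alternatingC-vanishes k<1+i) ⟨
  - alternatingC k (ℕ.suc i)          ∎
  where k<1+i = ℕ.s≤s (ℕP.≮⇒≥ i≮k)

alternatingC-pascal : ∀ k i →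
  alternatingC (ℕ.suc k) (ℕ.suc i) ≡ alternatingC k i ⊖ alternatingC k (ℕ.suc i)
alternatingC-pascal k i = begin
  s * + (ℕ.suc k C ℕ.suc i)                ≡⟨ cong (λ c → s * + c) (nCk+nC[k+1]≡[n+1]C[k+1] k i) ⟨
  s * (+ (k C i) ⊕ + (k C ℕ.suc i))        ≡⟨ ℤP.*-distribˡ-+ s (+ (k C i)) (+ (k C ℕ.suc i)) ⟩
  alternatingC k i ⊕ s * + (k C ℕ.suc i)   ≡⟨ cong (alternatingC k i ⊕_) (-1^[k∸i]*C[k,1+i] k i) ⟩
  alternatingC k i ⊖ alternatingC k (ℕ.suc i) ∎
  where s = -1ℤ ^ (k ∸ i)

Δ-extend : ∀ k h → Δ k h ≡ sumTo (2 ℕ.+ k) (λ i → alternatingC k i * h i)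
Δ-extend k h = begin
  Δ k h                                              ≡⟨ ℤP.+-identityʳ (Δ k h) ⟨
  Δ k h ⊕ + 0                                        ≡⟨ cong (Δ k h ⊕_) (ℤP.*-zeroˡ (h (ℕ.suc k))) ⟨
  Δ k h ⊕ + 0 * h (ℕ.suc k)                          ≡⟨ cong (λ a → Δ k h ⊕ a * h (ℕ.suc k)) (alternatingC-vanishes {k} ℕP.≤-refl) ⟨
  sumTo (2 ℕ.+ k) (λ i → alternatingC k i * h i)     ∎

Δ-suc : ∀ k h → Δ (ℕ.suc k) h ≡ Δ k (h ∘ ℕ.suc) ⊖ Δ k h
Δ-suc k h = begin
  Δ (ℕ.suc k) h
    ≡⟨ sumTo-suc (ℕ.suc k) _ ⟩
  alternatingC (ℕ.suc k) 0 * h 0 ⊕ sumTo (ℕ.suc k) (λ i → alternatingC (ℕ.suc k) (ℕ.suc i) * h (ℕ.suc i))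
    ≡⟨ cong₂ _⊕_ (cong (_* h 0) (alternatingC-suc-zero k)) (sumTo-cong (ℕ.suc k) pascal) ⟩
  - a₀ * h 0 ⊕ sumTo (ℕ.suc k) (λ i → alternatingC k i * h (ℕ.suc i) ⊖ alternatingC k (ℕ.suc i) * h (ℕ.suc i))
    ≡⟨ cong (- a₀ * h 0 ⊕_) (sumTo-distrib-⊖ (ℕ.suc k) _ _) ⟩
  - a₀ * h 0 ⊕ (Δ k (h ∘ ℕ.suc) ⊖ rest)
    ≡⟨ regroup a₀ (h 0) (Δ k (h ∘ ℕ.suc)) rest ⟩
  Δ k (h ∘ ℕ.suc) ⊖ (a₀ * h 0 ⊕ rest)
    ≡⟨ cong (Δ k (h ∘ ℕ.suc) ⊖_) (trans (Δ-extend k h) (sumTo-suc (ℕ.suc k) _)) ⟨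
  Δ k (h ∘ ℕ.suc) ⊖ Δ k h ∎
  where
  a₀ = alternatingC k 0
  rest = sumTo (ℕ.suc k) (λ i → alternatingC k (ℕ.suc i) * h (ℕ.suc i))
  pascal : ∀ i → alternatingC (ℕ.suc k) (ℕ.suc i) * h (ℕ.suc i)
                   ≡ alternatingC k i * h (ℕ.suc i) ⊖ alternatingC k (ℕ.suc i) * h (ℕ.suc i)
  pascal i = trans (cong (_* h (ℕ.suc i)) (alternatingC-pascal k i))
                   (*-distribʳ-⊖ (alternatingC k i) (alternatingC k (ℕ.suc i)) (h (ℕ.suc i)))
  regroup : ∀ a x y t → - a * x ⊕ (y ⊖ t) ≡ y ⊖ (a * x ⊕ t)
  regroup = solve-∀

Δ-cong : ∀ k {g h} → (∀ i → g i ≡ h i) → Δ k g ≡ Δ k h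
Δ-cong k g≡h = sumTo-cong (ℕ.suc k) (λ i → cong (alternatingC k i *_) (g≡h i))

Δ-distrib-⊖ : ∀ k g h → Δ k (λ i → g i ⊖ h i) ≡ Δ k g ⊖ Δ k h
Δ-distrib-⊖ k g h =
  trans (sumTo-cong (ℕ.suc k) (λ i → *-distribˡ-⊖ (alternatingC k i) (g i) (h i)))
        (sumTo-distrib-⊖ (ℕ.suc k) _ _)

*-distribˡ-Δ : ∀ k c h → c * Δ k h ≡ Δ k (λ i → c * h i)
*-distribˡ-Δ k c h =
  trans (*-distribˡ-sumTo (ℕ.suc k) c _)
        (sumTo-cong (ℕ.suc k) (λ i → *-left-comm c (alternatingC k i) (h i)))
  where
  *-left-comm : ∀ x y z → x * (y * z) ≡ y * (x * z)
  *-left-comm = solve-∀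

sumTo-Δ : ∀ k n (H : ℕ → ℕ → ℤ) → sumTo n (λ j → Δ k (H j)) ≡ Δ k (λ i → sumTo n (λ j → H j i))
sumTo-Δ k n H =
  trans (sumTo-comm n (ℕ.suc k) (λ j i → alternatingC k i * H j i))
        (sumTo-cong (ℕ.suc k) (λ i → sym (*-distribˡ-sumTo n (alternatingC k i) (λ j → H j i))))

binomial-increment : ∀ m R z →
  (z ⊕ R) ^ m ⊖ z ^ m ≡ sumFrom1 m (λ j → R ^ j * + (m C j) * z ^ (m ∸ j))
binomial-increment m R z = begin
  (z ⊕ R) ^ m ⊖ z ^ m                    ≡⟨ cong (λ x → x ^ m ⊖ z ^ m) (ℤP.+-comm z R) ⟩
  (R ⊕ z) ^ m ⊖ z ^ m                    ≡⟨ cong (_⊖ z ^ m) (binomial-theorem m R z) ⟩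
  sumTo (ℕ.suc m) term ⊖ z ^ m           ≡⟨ cong (_⊖ z ^ m) (sumTo-suc m term) ⟩
  (+ 1 * + 1 * z ^ m ⊕ sumFrom1 m term) ⊖ z ^ m ≡⟨ cancel (z ^ m) (sumFrom1 m term) ⟩
  sumFrom1 m term                        ∎
  where
  term : ℕ → ℤ
  term j = R ^ j * + (m C j) * z ^ (m ∸ j)
  cancel : ∀ x s → (+ 1 * + 1 * x ⊕ s) ⊖ x ≡ s
  cancel = solve-∀

g : ℕ → ℕ → ℕ → ℤ
g r m i = (+ r * + i ⊕ + r) ^ m ⊖ (+ r * + i ⊕ + r ⊖ + 1) ^ m

f≡Δg : ∀ r k m → f r (ℕ.suc k) m ≡ Δ k (g r m)
f≡Δg r k m = refl

g-increment : ∀ r m i →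
  g r m (ℕ.suc i) ⊖ g r m i ≡ sumFrom1 m (λ j → (+ r) ^ j * + (m C j) * g r (m ∸ j) i)
g-increment r m i = begin
  g r m (ℕ.suc i) ⊖ g r m i
    ≡⟨ cong₂ (λ u v → (u ^ m ⊖ v ^ m) ⊖ g r m i) next (trans (cong (_⊖ + 1) next) (shift y R)) ⟩
  ((y ⊕ R) ^ m ⊖ (y′ ⊕ R) ^ m) ⊖ (y ^ m ⊖ y′ ^ m)
    ≡⟨ interchange ((y ⊕ R) ^ m) ((y′ ⊕ R) ^ m) (y ^ m) (y′ ^ m) ⟩
  ((y ⊕ R) ^ m ⊖ y ^ m) ⊖ ((y′ ⊕ R) ^ m ⊖ y′ ^ m)
    ≡⟨ cong₂ _⊖_ (binomial-increment m R y) (binomial-increment m R y′) ⟩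
  sumFrom1 m (term y) ⊖ sumFrom1 m (term y′)
    ≡⟨ sumTo-distrib-⊖ m _ _ ⟨
  sumFrom1 m (λ j → term y j ⊖ term y′ j)
    ≡⟨ sumTo-cong m (λ j → *-distribˡ-⊖ (R ^ ℕ.suc j * + (m C ℕ.suc j)) _ _) ⟨
  sumFrom1 m (λ j → R ^ j * + (m C j) * g r (m ∸ j) i) ∎
  where
  R  = + r
  y  = R * + i ⊕ R
  y′ = y ⊖ + 1
  term : ℤ → ℕ → ℤ
  term z j = R ^ j * + (m C j) * z ^ (m ∸ j)
  next : R * + ℕ.suc i ⊕ R ≡ y ⊕ R
  next = cong (_⊕ R) (trans (ℤP.*-suc R (+ i)) (ℤP.+-comm R (R * + i)))
  shift : ∀ x a → x ⊕ a ⊖ + 1 ≡ (x ⊖ + 1) ⊕ a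
  shift = solve-∀
  interchange : ∀ a b c d → (a ⊖ b) ⊖ (c ⊖ d) ≡ (a ⊖ c) ⊖ (b ⊖ d)
  interchange = solve-∀

lemma4p3 : (r d l m : ℕ) → 1 ≤ r → 1 ≤ d → 1 ≤ l → l + 1 ≤ d → 1 ≤ m → m ≤ d →
    sumFrom1 m (λ j → ((+ r) ^ j) * (+ (m C j)) * f r l (m ∸ j)) ≡ f r (l + 1) m
lemma4p3 r _ (ℕ.suc k) m _ _ _ _ _ _ = begin
  sumFrom1 m (λ j → c j * f r (ℕ.suc k) (m ∸ j))
    ≡⟨ sumTo-cong m (λ j → *-distribˡ-Δ k (c (ℕ.suc j)) (g r (m ∸ ℕ.suc j))) ⟩
  sumFrom1 m (λ j → Δ k (λ i → c j * g r (m ∸ j) i))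
    ≡⟨ sumTo-Δ k m _ ⟩
  Δ k (λ i → sumFrom1 m (λ j → c j * g r (m ∸ j) i))
    ≡⟨ Δ-cong k (λ i → g-increment r m i) ⟨
  Δ k (λ i → g r m (ℕ.suc i) ⊖ g r m i)
    ≡⟨ Δ-distrib-⊖ k _ _ ⟩
  Δ k (g r m ∘ ℕ.suc) ⊖ Δ k (g r m)
    ≡⟨ Δ-suc k (g r m) ⟨
  Δ (ℕ.suc k) (g r m)
    ≡⟨ cong (λ n → Δ n (g r m)) (ℕP.+-comm 1 k) ⟩
  Δ (k + 1) (g r m)
    ≡⟨ f≡Δg r (k + 1) m ⟨
  f r (ℕ.suc k + 1) m ∎
  where
  c : ℕ → ℤ
  c j = (+ r) ^ j * + (m C j)
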